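{- Let $d\geq 2$ be an integer. For $\theta=(\theta_1,\ldots,\theta_{d-1})\in[0,1]^{d-1}$, consider the Markov chain on states $\{0,1,\ldots,d-1\}$ which, from a state $j\leq d-2$, moves to $j+1$ with probability $1-\theta_{j+1}$ and stays at $j$ with probability $\theta_{j+1}$, and for which state $d-1$ is absorbing; let $\mathcal{F}(\theta)$ be the expected state after $d$ steps started from state $0$. Then for every $j\in\{1,\ldots,d-1\}$, with all other coordinates fixed, $\mathcal{F}$ is a concave function of $\theta_j$.
   Formalization: The coordinates of θ, the two values of θ_j compared in the concavity inequality, and the weight of the convex combination are all rational numbers in [0,1]. -}

module Defs where

open import Data.Nat using (ℕ; zero; suc)
open import Data.Fin using (Fin; zero; suc; inject₁; toℕ)
open import Data.Rational using (ℚ; 0ℚ; 1ℚ; _+_; _*_; _-_; _/_)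
open import Data.Integer using (+_)
open import Data.Vec.Functional using (updateAt)
open import Function using (_∘_; const)

-- The chain lives on states Fin (suc n) = {0,…,n}, i.e. d = suc n.
-- θ : Fin n → ℚ, where θ i stands for the paper's θ_{toℕ i + 1}.

-- probability of staying at state k (state n = d-1 is absorbing)
stay : ∀ {n} → (Fin n → ℚ) → Fin (suc n) → ℚ
stay {zero}  θ zero    = 1ℚ
stay {suc n} θ zero    = θ zero
stay {suc n} θ (suc k) = stay (θ ∘ suc) k

step : ∀ {n} → (Fin n → ℚ) → (Fin (suc n) → ℚ) → Fin (suc n) → ℚ
step θ p zero    = stay θ zero * p zero
step θ p (suc k) = stay θ (suc k) * p (suc k) + (1ℚ - θ k) * p (inject₁ k)

start : ∀ {n} → Fin (suc n) → ℚ
start zero    = 1ℚ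
start (suc k) = 0ℚ

iterate : ∀ {A : Set} → ℕ → (A → A) → A → A
iterate zero    f a = a
iterate (suc m) f a = f (iterate m f a)

sumFin : ∀ {n} → (Fin n → ℚ) → ℚ
sumFin {zero}  f = 0ℚ
sumFin {suc n} f = f zero + sumFin (f ∘ suc)

expect : ∀ {n} → (Fin n → ℚ) → ℚ
expect p = sumFin (λ k → (+ toℕ k / 1) * p k)

𝓕 : ∀ {n} → (Fin n → ℚ) → ℚ
𝓕 {n} θ = expect (iterate (suc n) (step θ) start)

_[_≔_] : ∀ {n} → (Fin n → ℚ) → Fin n → ℚ → Fin n → ℚ
θ [ j ≔ x ] = updateAt θ j (const x)

-- Let R_m(k) be the probability that the chain has reached state k after m steps, and write
-- mix t a b = t a + (1 - t) b. Then 𝓕(θ) = Σ_{k ≥ 1} R_d(k), R_m(0) = 1, and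
-- R_{m+1}(k+1) = mix θ_k (R_m(k+1)) (R_m(k)), where θ_k is the probability of staying at k.
-- Induction on m shows that R_m is antitone in k and in θ, and that R_m(k) for k ≤ j does not
-- involve θ_j. Concavity of R_m(k) in θ_j then propagates through the recursion: for k ≠ j it
-- is the interchange law of mix, and for k = j the two points share R_m(j), leaving the term
-- t (1 - t) (x - y) (R^y_m(j+1) - R^x_m(j+1)), which is nonnegative by antitonicity in θ.
{-# OPTIONS --safe #-}
module Submission where

open import Defs
open import Data.Nat using (ℕ)
open import Data.Fin using (Fin)
open import Data.Product using (_×_)
open import Data.Rational using (ℚ; 0ℚ; 1ℚ; _+_; _*_; _-_; _≤_)

open import Data.Nat as ℕ using (zero; suc)
import Data.Nat.Properties as ℕ
open import Data.Fin as Fin using (zero; suc; inject₁; toℕ)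
import Data.Fin.Properties as Fin
import Data.Integer as ℤ
import Data.Integer.Properties as ℤ
open import Data.Rational as ℚ using (-_; _/_)
import Data.Rational.Properties as ℚ
open import Data.Rational.Solver using (module +-*-Solver)
open +-*-Solver using (solve; _:=_; _:+_; _:-_; _:*_; con)
import Data.Nat.Coprimality as Coprime
open import Algebra.Properties.CommutativeMonoid.Sum ℚ.+-0-commutativeMonoid
  using (sum; sum-cong-≗; ∑-distrib-+; sum-replicate-zero)
open import Data.Product using (_,_)
open import Data.Sum using (inj₁; inj₂)
open import Data.Vec.Functional.Properties using (updateAt-updates; updateAt-minimal)
open import Function using (_∘_)
open import Relation.Binary.PropositionalEquality
  using (_≡_; _≢_; refl; sym; trans; cong; cong₂; subst; subst₂; module ≡-Reasoning)
open import Relation.Nullary using (yes; no)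

_∈[0,1] : ℚ → Set
p ∈[0,1] = 0ℚ ≤ p × p ≤ 1ℚ

0≤1 : 0ℚ ≤ 1ℚ
0≤1 = ℚ.≤ᵇ⇒≤ _

0≤p*q : ∀ {p q} → 0ℚ ≤ p → 0ℚ ≤ q → 0ℚ ≤ p * q
0≤p*q {p} {q} 0≤p 0≤q = ℚ.nonNegative⁻¹ (p * q)
  {{ℚ.nonNeg*nonNeg⇒nonNeg p {{ℚ.nonNegative 0≤p}} q {{ℚ.nonNegative 0≤q}}}}

p≤q⇒0≤q-p : ∀ {p q} → p ≤ q → 0ℚ ≤ q - p
p≤q⇒0≤q-p {p} {q} p≤q = subst (_≤ q - p) (ℚ.+-inverseʳ p) (ℚ.+-monoˡ-≤ (- p) p≤q)

0≤q-p⇒p≤q : ∀ {p q} → 0ℚ ≤ q - p → p ≤ q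
0≤q-p⇒p≤q {p} {q} 0≤q-p = subst₂ _≤_ (ℚ.+-identityˡ p)
  (solve 2 (λ p q → (q :- p) :+ p := q) refl p q) (ℚ.+-monoˡ-≤ p 0≤q-p)

≤-byDifference : ∀ {p q} r → q - p ≡ r → 0ℚ ≤ r → p ≤ q
≤-byDifference r q-p≡r 0≤r = 0≤q-p⇒p≤q (subst (0ℚ ≤_) (sym q-p≡r) 0≤r)

0≤[p-q]*[r-s] : ∀ {p q r s} → (p ≤ q → r ≤ s) → (q ≤ p → s ≤ r) → 0ℚ ≤ (p - q) * (r - s)
0≤[p-q]*[r-s] {p} {q} {r} {s} p≤q⇒r≤s q≤p⇒s≤r with ℚ.≤-total p q
... | inj₁ p≤q = subst (0ℚ ≤_)
  (solve 4 (λ p q r s → (q :- p) :* (s :- r) := (p :- q) :* (r :- s)) refl p q r s)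
  (0≤p*q (p≤q⇒0≤q-p p≤q) (p≤q⇒0≤q-p (p≤q⇒r≤s p≤q)))
... | inj₂ q≤p = 0≤p*q (p≤q⇒0≤q-p q≤p) (p≤q⇒0≤q-p (q≤p⇒s≤r q≤p))

mix : ℚ → ℚ → ℚ → ℚ
mix t a b = t * a + (1ℚ - t) * b

mix-cong-weight : ∀ {s t} a b → s ≡ t → mix s a b ≡ mix t a b
mix-cong-weight a b refl = refl

mix-idem : ∀ t a → mix t a a ≡ a
mix-idem = solve 2 (λ t a → t :* a :+ (con 1ℚ :- t) :* a := a) refl

mix-mono-≤ : ∀ {t a a′ b b′} → t ∈[0,1] → a ≤ a′ → b ≤ b′ → mix t a b ≤ mix t a′ b′
mix-mono-≤ {t} (0≤t , t≤1) a≤a′ b≤b′ = ℚ.+-mono-≤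
  (ℚ.*-monoˡ-≤-nonNeg t {{ℚ.nonNegative 0≤t}} a≤a′)
  (ℚ.*-monoˡ-≤-nonNeg (1ℚ - t) {{ℚ.nonNegative (p≤q⇒0≤q-p t≤1)}} b≤b′)

mix-≤ʳ : ∀ {t a b} → t ∈[0,1] → a ≤ b → mix t a b ≤ b
mix-≤ʳ {t} {b = b} t∈ a≤b = ℚ.≤-trans (mix-mono-≤ t∈ a≤b ℚ.≤-refl) (ℚ.≤-reflexive (mix-idem t b))

mix-≥ˡ : ∀ {t a b} → t ∈[0,1] → a ≤ b → a ≤ mix t a b
mix-≥ˡ {t} {a} t∈ a≤b = ℚ.≤-trans (ℚ.≤-reflexive (sym (mix-idem t a))) (mix-mono-≤ t∈ ℚ.≤-refl a≤b)

mix-∈[0,1] : ∀ {t a b} → t ∈[0,1] → a ∈[0,1] → b ∈[0,1] → mix t a b ∈[0,1]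
mix-∈[0,1] {t} t∈ (0≤a , a≤1) (0≤b , b≤1) =
  subst (_≤ mix t _ _) (mix-idem t 0ℚ) (mix-mono-≤ t∈ 0≤a 0≤b) ,
  subst (mix t _ _ ≤_) (mix-idem t 1ℚ) (mix-mono-≤ t∈ a≤1 b≤1)

mix-antitone-weight : ∀ {s t a b} → s ≤ t → a ≤ b → mix t a b ≤ mix s a b
mix-antitone-weight {s} {t} {a} {b} s≤t a≤b = ≤-byDifference ((t - s) * (b - a))
  (solve 4 (λ s t a b → (s :* a :+ (con 1ℚ :- s) :* b) :- (t :* a :+ (con 1ℚ :- t) :* b)
                        := (t :- s) :* (b :- a)) refl s t a b)
  (0≤p*q (p≤q⇒0≤q-p s≤t) (p≤q⇒0≤q-p a≤b))

mix-interchange : ∀ t s a b c d → mix t (mix s a b) (mix s c d) ≡ mix s (mix t a c) (mix t b d)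
mix-interchange = solve 6 (λ t s a b c d →
  t :* (s :* a :+ (con 1ℚ :- s) :* b) :+ (con 1ℚ :- t) :* (s :* c :+ (con 1ℚ :- s) :* d)
  := s :* (t :* a :+ (con 1ℚ :- t) :* c) :+ (con 1ℚ :- s) :* (t :* b :+ (con 1ℚ :- t) :* d)) refl

mix-mix-≤ : ∀ {t α β u u′} v → t ∈[0,1] → (α ≤ β → u′ ≤ u) → (β ≤ α → u ≤ u′) →
  mix t (mix α u v) (mix β u′ v) ≤ mix (mix t α β) (mix t u u′) v
mix-mix-≤ {t} {α} {β} {u} {u′} v (0≤t , t≤1) α≤β⇒u′≤u β≤α⇒u≤u′ =
  ≤-byDifference (t * (1ℚ - t) * ((α - β) * (u′ - u)))
    (solve 6 (λ t α β u u′ v →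
      ((t :* α :+ (con 1ℚ :- t) :* β) :* (t :* u :+ (con 1ℚ :- t) :* u′)
        :+ (con 1ℚ :- (t :* α :+ (con 1ℚ :- t) :* β)) :* v)
      :- (t :* (α :* u :+ (con 1ℚ :- α) :* v) :+ (con 1ℚ :- t) :* (β :* u′ :+ (con 1ℚ :- β) :* v))
      := t :* (con 1ℚ :- t) :* ((α :- β) :* (u′ :- u))) refl t α β u u′ v)
    (0≤p*q (0≤p*q 0≤t (p≤q⇒0≤q-p t≤1)) (0≤[p-q]*[r-s] α≤β⇒u′≤u β≤α⇒u≤u′))

sumFin≡sum : ∀ {n} (f : Fin n → ℚ) → sumFin f ≡ sum f
sumFin≡sum {zero}  f = refl
sumFin≡sum {suc n} f = cong (f zero +_) (sumFin≡sum (f ∘ suc))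

sumFin-cong : ∀ {n} {f g : Fin n → ℚ} → (∀ i → f i ≡ g i) → sumFin f ≡ sumFin g
sumFin-cong {f = f} {g} f≗g = trans (sumFin≡sum f) (trans (sum-cong-≗ f≗g) (sym (sumFin≡sum g)))

sumFin-+ : ∀ {n} (f g : Fin n → ℚ) → sumFin (λ i → f i + g i) ≡ sumFin f + sumFin g
sumFin-+ f g = trans (sumFin≡sum (λ i → f i + g i))
  (trans (∑-distrib-+ f g) (sym (cong₂ _+_ (sumFin≡sum f) (sumFin≡sum g))))

sumFin-zero : ∀ n → sumFin {n} (λ _ → 0ℚ) ≡ 0ℚ
sumFin-zero n = trans (sumFin≡sum {n} (λ _ → 0ℚ)) (sum-replicate-zero n)

mix-sumFin-≤ : ∀ {n} t {f g h : Fin n → ℚ} → (∀ i → mix t (f i) (g i) ≤ h i) →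
  mix t (sumFin f) (sumFin g) ≤ sumFin h
mix-sumFin-≤ {zero}  t _ = ℚ.≤-reflexive (mix-idem t 0ℚ)
mix-sumFin-≤ {suc n} t {f} {g} {h} fg≤h = subst (_≤ sumFin h)
  (solve 5 (λ t a b A B → (t :* a :+ (con 1ℚ :- t) :* b) :+ (t :* A :+ (con 1ℚ :- t) :* B)
                          := t :* (a :+ A) :+ (con 1ℚ :- t) :* (b :+ B))
    refl t (f zero) (g zero) (sumFin (f ∘ suc)) (sumFin (g ∘ suc)))
  (ℚ.+-mono-≤ (fg≤h zero) (mix-sumFin-≤ t (fg≤h ∘ suc)))

tailSum : ∀ {n} → (Fin (suc n) → ℚ) → Fin (suc n) → ℚ
tailSum p zero = sumFin p
tailSum {suc n} p (suc k) = tailSum (p ∘ suc) k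

tailSum-cong-suc : ∀ {n} {p q : Fin (suc n) → ℚ} → (∀ i → p (suc i) ≡ q (suc i)) →
  ∀ k → tailSum p (suc k) ≡ tailSum q (suc k)
tailSum-cong-suc {suc n} p≗q zero    = sumFin-cong p≗q
tailSum-cong-suc {suc n} p≗q (suc k) = tailSum-cong-suc (p≗q ∘ suc) k

tailSum-zero : ∀ {n} (k : Fin (suc n)) → tailSum (λ _ → 0ℚ) k ≡ 0ℚ
tailSum-zero {n} zero = sumFin-zero (suc n)
tailSum-zero {suc n} (suc k) = tailSum-zero k

sumFin-step-suc : ∀ {n} (θ : Fin (suc n) → ℚ) (p : Fin (suc (suc n)) → ℚ) →
  sumFin (step θ p ∘ suc) ≡ (1ℚ - θ zero) * p zero + sumFin (step (θ ∘ suc) (p ∘ suc))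
sumFin-step-suc θ p = solve 3 (λ a c s → (a :+ c) :+ s := c :+ (a :+ s)) refl
  (step (θ ∘ suc) (p ∘ suc) zero) ((1ℚ - θ zero) * p zero) (sumFin (step (θ ∘ suc) (p ∘ suc) ∘ suc))

sumFin-step : ∀ {n} (θ : Fin n → ℚ) (p : Fin (suc n) → ℚ) → sumFin (step θ p) ≡ sumFin p
sumFin-step {zero}  θ p = cong (_+ 0ℚ) (ℚ.*-identityˡ (p zero))
sumFin-step {suc n} θ p = begin
  θ zero * p zero + sumFin (step θ p ∘ suc)
    ≡⟨ cong (θ zero * p zero +_) (sumFin-step-suc θ p) ⟩
  θ zero * p zero + ((1ℚ - θ zero) * p zero + sumFin (step (θ ∘ suc) (p ∘ suc)))
    ≡⟨ cong (λ s → θ zero * p zero + ((1ℚ - θ zero) * p zero + s)) (sumFin-step (θ ∘ suc) (p ∘ suc)) ⟩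
  θ zero * p zero + ((1ℚ - θ zero) * p zero + sumFin (p ∘ suc))
    ≡⟨ solve 3 (λ a b s → a :* b :+ ((con 1ℚ :- a) :* b :+ s) := b :+ s) refl (θ zero) (p zero) _ ⟩
  p zero + sumFin (p ∘ suc) ∎
  where open ≡-Reasoning

tailSum-step : ∀ {n} (θ : Fin n → ℚ) (p : Fin (suc n) → ℚ) (k : Fin n) →
  tailSum (step θ p) (suc k) ≡ mix (θ k) (tailSum p (suc k)) (tailSum p (inject₁ k))
tailSum-step {suc n} θ p zero = begin
  sumFin (step θ p ∘ suc)
    ≡⟨ sumFin-step-suc θ p ⟩
  (1ℚ - θ zero) * p zero + sumFin (step (θ ∘ suc) (p ∘ suc))
    ≡⟨ cong ((1ℚ - θ zero) * p zero +_) (sumFin-step (θ ∘ suc) (p ∘ suc)) ⟩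
  (1ℚ - θ zero) * p zero + sumFin (p ∘ suc)
    ≡⟨ solve 3 (λ a b s → (con 1ℚ :- a) :* b :+ s := a :* s :+ (con 1ℚ :- a) :* (b :+ s))
         refl (θ zero) (p zero) (sumFin (p ∘ suc)) ⟩
  mix (θ zero) (sumFin (p ∘ suc)) (p zero + sumFin (p ∘ suc)) ∎
  where open ≡-Reasoning
tailSum-step {suc n} θ p (suc k) = trans
  (tailSum-cong-suc {p = step θ p ∘ suc} (λ _ → refl) k)
  (tailSum-step (θ ∘ suc) (p ∘ suc) k)

+suc/1≡1++/1 : ∀ m → ℤ.+ suc m / 1 ≡ 1ℚ + ℤ.+ m / 1
+suc/1≡1++/1 m = sym (trans
  (cong (1ℚ +_) (ℚ.normalize-coprime (Coprime.sym (Coprime.1-coprimeTo m))))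
  (ℚ./-cong (cong (ℤ._+_ ℤ.1ℤ) (ℤ.*-identityʳ (ℤ.+ m))) refl))

expect-suc : ∀ {n} (p : Fin (suc (suc n)) → ℚ) → expect p ≡ sumFin (p ∘ suc) + expect (p ∘ suc)
expect-suc p = begin
  0ℚ * p zero + sumFin (λ k → (ℤ.+ toℕ (suc k) / 1) * p (suc k))
    ≡⟨ trans (cong (_+ S) (ℚ.*-zeroˡ (p zero))) (ℚ.+-identityˡ S) ⟩
  S
    ≡⟨ sumFin-cong (λ k → trans (cong (_* p (suc k)) (+suc/1≡1++/1 (toℕ k)))
         (solve 2 (λ w q → (con 1ℚ :+ w) :* q := q :+ w :* q) refl (ℤ.+ toℕ k / 1) (p (suc k)))) ⟩
  sumFin (λ k → p (suc k) + (ℤ.+ toℕ k / 1) * p (suc k))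
    ≡⟨ sumFin-+ (p ∘ suc) (λ k → (ℤ.+ toℕ k / 1) * p (suc k)) ⟩
  sumFin (p ∘ suc) + expect (p ∘ suc) ∎
  where
  open ≡-Reasoning
  S : ℚ
  S = sumFin (λ k → (ℤ.+ toℕ (suc k) / 1) * p (suc k))

expect≡sumFin-tailSum : ∀ {n} (p : Fin (suc n) → ℚ) → expect p ≡ sumFin (λ k → tailSum p (suc k))
expect≡sumFin-tailSum {zero}  p = trans (cong (_+ 0ℚ) (ℚ.*-zeroˡ (p zero))) (ℚ.+-identityʳ 0ℚ)
expect≡sumFin-tailSum {suc n} p =
  trans (expect-suc p) (cong (sumFin (p ∘ suc) +_) (expect≡sumFin-tailSum (p ∘ suc)))

-- The chain never moves down, so the mass on states ≥ k is the probability of having reached k.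
reached : ∀ {n} → (Fin n → ℚ) → ℕ → Fin (suc n) → ℚ
reached θ m = tailSum (iterate m (step θ) start)

𝓕≡sumFin-reached : ∀ {n} (θ : Fin n → ℚ) → 𝓕 θ ≡ sumFin (λ k → reached θ (suc n) (suc k))
𝓕≡sumFin-reached {n} θ = expect≡sumFin-tailSum (iterate (suc n) (step θ) start)

reached-zero : ∀ {n} (θ : Fin n → ℚ) m → reached θ m zero ≡ 1ℚ
reached-zero {n} θ zero    = trans (cong (1ℚ +_) (sumFin-zero n)) (ℚ.+-identityʳ 1ℚ)
reached-zero     θ (suc m) = trans (sumFin-step θ (iterate m (step θ) start)) (reached-zero θ m)

reached-start : ∀ {n} (θ : Fin n → ℚ) k → reached θ 0 (suc k) ≡ 0ℚ
reached-start {suc n} θ k = tailSum-zero k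

reached-suc : ∀ {n} (θ : Fin n → ℚ) m k →
  reached θ (suc m) (suc k) ≡ mix (θ k) (reached θ m (suc k)) (reached θ m (inject₁ k))
reached-suc θ m = tailSum-step θ (iterate m (step θ) start)

module _ {n} {θ : Fin n → ℚ} (θ∈ : ∀ i → θ i ∈[0,1]) where

  reached-increasing : ∀ m → (∀ k → reached θ m (suc k) ≤ reached θ m (inject₁ k)) →
    ∀ k → reached θ m k ≤ reached θ (suc m) k
  reached-increasing m _ zero =
    ℚ.≤-reflexive (trans (reached-zero θ m) (sym (reached-zero θ (suc m))))
  reached-increasing m antitone (suc k) =
    subst (reached θ m (suc k) ≤_) (sym (reached-suc θ m k)) (mix-≥ˡ (θ∈ k) (antitone k))

  reached-suc≤reached-inject₁ : ∀ m k → reached θ m (suc k) ≤ reached θ m (inject₁ k)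
  reached-suc≤reached-inject₁ zero k =
    subst (_≤ reached θ 0 (inject₁ k)) (sym (reached-start θ k)) (0≤reached-start (inject₁ k))
    where
    0≤reached-start : ∀ k → 0ℚ ≤ reached θ 0 k
    0≤reached-start zero    = subst (0ℚ ≤_) (sym (reached-zero θ 0)) 0≤1
    0≤reached-start (suc k) = ℚ.≤-reflexive (sym (reached-start θ k))
  reached-suc≤reached-inject₁ (suc m) k = begin
    reached θ (suc m) (suc k)
      ≡⟨ reached-suc θ m k ⟩
    mix (θ k) (reached θ m (suc k)) (reached θ m (inject₁ k))
      ≤⟨ mix-≤ʳ (θ∈ k) (reached-suc≤reached-inject₁ m k) ⟩
    reached θ m (inject₁ k)
      ≤⟨ reached-increasing m (reached-suc≤reached-inject₁ m) (inject₁ k) ⟩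
    reached θ (suc m) (inject₁ k) ∎
    where open ℚ.≤-Reasoning

reached-antitone : ∀ {n} {θ θ′ : Fin n → ℚ} → (∀ i → θ i ∈[0,1]) → (∀ i → θ′ i ∈[0,1]) →
  (∀ i → θ i ≤ θ′ i) → ∀ m k → reached θ′ m k ≤ reached θ m k
reached-antitone θ∈ θ′∈ θ≤θ′ zero k = ℚ.≤-refl
reached-antitone {θ = θ} {θ′} θ∈ θ′∈ θ≤θ′ (suc m) zero =
  ℚ.≤-reflexive (trans (reached-zero θ′ (suc m)) (sym (reached-zero θ (suc m))))
reached-antitone {θ = θ} {θ′} θ∈ θ′∈ θ≤θ′ (suc m) (suc k) = begin
  reached θ′ (suc m) (suc k)
    ≡⟨ reached-suc θ′ m k ⟩
  mix (θ′ k) (reached θ′ m (suc k)) (reached θ′ m (inject₁ k))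
    ≤⟨ mix-antitone-weight (θ≤θ′ k) (reached-suc≤reached-inject₁ θ′∈ m k) ⟩
  mix (θ k) (reached θ′ m (suc k)) (reached θ′ m (inject₁ k))
    ≤⟨ mix-mono-≤ (θ∈ k) (IH (suc k)) (IH (inject₁ k)) ⟩
  mix (θ k) (reached θ m (suc k)) (reached θ m (inject₁ k))
    ≡⟨ sym (reached-suc θ m k) ⟩
  reached θ (suc m) (suc k) ∎
  where
  open ℚ.≤-Reasoning
  IH : ∀ k → reached θ′ m k ≤ reached θ m k
  IH = reached-antitone θ∈ θ′∈ θ≤θ′ m

reached-cong-≤ : ∀ {n} {θ θ′ : Fin n → ℚ} j → (∀ i → i ≢ j → θ i ≡ θ′ i) →
  ∀ m k → k Fin.≤ j → reached θ m k ≡ reached θ′ m k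
reached-cong-≤ j θ≡θ′ zero k k≤j = refl
reached-cong-≤ {θ = θ} {θ′} j θ≡θ′ (suc m) zero k≤j =
  trans (reached-zero θ (suc m)) (sym (reached-zero θ′ (suc m)))
reached-cong-≤ {θ = θ} {θ′} j θ≡θ′ (suc m) (suc k) k<j = begin
  reached θ (suc m) (suc k)
    ≡⟨ reached-suc θ m k ⟩
  mix (θ k) (reached θ m (suc k)) (reached θ m (inject₁ k))
    ≡⟨ mix-cong-weight (reached θ m (suc k)) (reached θ m (inject₁ k)) (θ≡θ′ k (Fin.<⇒≢ k<j)) ⟩
  mix (θ′ k) (reached θ m (suc k)) (reached θ m (inject₁ k))
    ≡⟨ cong₂ (mix (θ′ k)) (IH (suc k) k<j) (IH (inject₁ k) inject₁k≤j) ⟩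
  mix (θ′ k) (reached θ′ m (suc k)) (reached θ′ m (inject₁ k))
    ≡⟨ sym (reached-suc θ′ m k) ⟩
  reached θ′ (suc m) (suc k) ∎
  where
  open ≡-Reasoning
  IH : ∀ k → k Fin.≤ j → reached θ m k ≡ reached θ′ m k
  IH = reached-cong-≤ j θ≡θ′ m
  inject₁k≤j : inject₁ k Fin.≤ j
  inject₁k≤j = subst (ℕ._≤ toℕ j) (sym (Fin.toℕ-inject₁ k)) (ℕ.<⇒≤ k<j)

module _ {n} (θ : Fin n → ℚ) (j : Fin n) where

  update-≢ : ∀ {s s′} i → i ≢ j → (θ [ j ≔ s ]) i ≡ (θ [ j ≔ s′ ]) i
  update-≢ i i≢j = trans (updateAt-minimal i j θ i≢j) (sym (updateAt-minimal i j θ i≢j))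

  update-∈[0,1] : (∀ i → θ i ∈[0,1]) → ∀ {s} → s ∈[0,1] → ∀ i → (θ [ j ≔ s ]) i ∈[0,1]
  update-∈[0,1] θ∈ s∈ i with i Fin.≟ j
  ... | yes refl = subst _∈[0,1] (sym (updateAt-updates i θ)) s∈
  ... | no i≢j   = subst _∈[0,1] (sym (updateAt-minimal i j θ i≢j)) (θ∈ i)

  update-≤ : ∀ {s s′} → (θ [ j ≔ s ]) j ≤ (θ [ j ≔ s′ ]) j → ∀ i → (θ [ j ≔ s ]) i ≤ (θ [ j ≔ s′ ]) i
  update-≤ ≤-at-j i with i Fin.≟ j
  ... | yes refl = ≤-at-j
  ... | no i≢j   = ℚ.≤-reflexive (update-≢ i i≢j)

  update-mix : ∀ t s s′ i → (θ [ j ≔ mix t s s′ ]) i ≡ mix t ((θ [ j ≔ s ]) i) ((θ [ j ≔ s′ ]) i)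
  update-mix t s s′ i with i Fin.≟ j
  ... | yes refl = trans (updateAt-updates i θ)
    (sym (cong₂ (mix t) (updateAt-updates i θ) (updateAt-updates i θ)))
  ... | no i≢j   = trans (updateAt-minimal i j θ i≢j) (trans (sym (mix-idem t (θ i)))
    (sym (cong₂ (mix t) (updateAt-minimal i j θ i≢j) (updateAt-minimal i j θ i≢j))))

module _ {n} {θ : Fin n → ℚ} (θ∈ : ∀ i → θ i ∈[0,1]) (j : Fin n)
         {t x y : ℚ} (t∈ : t ∈[0,1]) (x∈ : x ∈[0,1]) (y∈ : y ∈[0,1]) where

  private
    θ⟨_⟩ : ℚ → Fin n → ℚ
    θ⟨ s ⟩ = θ [ j ≔ s ]

    R : ℚ → ℕ → Fin (suc n) → ℚ
    R s = reached θ⟨ s ⟩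

    U V : ℚ → ℕ → Fin n → ℚ
    U s m k = R s m (suc k)
    V s m k = R s m (inject₁ k)

    R-antitone : ∀ {s s′} → s ∈[0,1] → s′ ∈[0,1] → θ⟨ s ⟩ j ≤ θ⟨ s′ ⟩ j → ∀ m k → R s′ m k ≤ R s m k
    R-antitone s∈ s′∈ ≤-at-j = reached-antitone
      (update-∈[0,1] θ j θ∈ s∈) (update-∈[0,1] θ j θ∈ s′∈) (update-≤ θ j ≤-at-j)

  mix-reached-suc-≤ : ∀ m k → mix t (R x (suc m) (suc k)) (R y (suc m) (suc k)) ≤
    mix (mix t (θ⟨ x ⟩ k) (θ⟨ y ⟩ k)) (mix t (U x m k) (U y m k)) (mix t (V x m k) (V y m k))
  mix-reached-suc-≤ m k with k Fin.≟ j
  ... | no k≢j = ℚ.≤-reflexive (begin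
    mix t (R x (suc m) (suc k)) (R y (suc m) (suc k))
      ≡⟨ cong₂ (mix t) (reached-suc θ⟨ x ⟩ m k)
           (trans (reached-suc θ⟨ y ⟩ m k) (mix-cong-weight (U y m k) (V y m k) (sym θxk≡θyk))) ⟩
    mix t (mix α (U x m k) (V x m k)) (mix α (U y m k) (V y m k))
      ≡⟨ mix-interchange t α (U x m k) (V x m k) (U y m k) (V y m k) ⟩
    mix α (mix t (U x m k) (U y m k)) (mix t (V x m k) (V y m k))
      ≡⟨ mix-cong-weight (mix t (U x m k) (U y m k)) (mix t (V x m k) (V y m k))
           (trans (sym (mix-idem t α)) (cong (mix t α) θxk≡θyk)) ⟩
    mix (mix t α (θ⟨ y ⟩ k)) (mix t (U x m k) (U y m k)) (mix t (V x m k) (V y m k)) ∎)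
    where
    open ≡-Reasoning
    α : ℚ
    α = θ⟨ x ⟩ k
    θxk≡θyk : α ≡ θ⟨ y ⟩ k
    θxk≡θyk = update-≢ θ j k k≢j
  ... | yes refl = begin
    mix t (R x (suc m) (suc j)) (R y (suc m) (suc j))
      ≡⟨ cong₂ (mix t) (reached-suc θ⟨ x ⟩ m j)
           (trans (reached-suc θ⟨ y ⟩ m j) (cong (mix (θ⟨ y ⟩ j) (U y m j)) (sym Vx≡Vy))) ⟩
    mix t (mix (θ⟨ x ⟩ j) (U x m j) (V x m j)) (mix (θ⟨ y ⟩ j) (U y m j) (V x m j))
      ≤⟨ mix-mix-≤ (V x m j) t∈ (λ ≤-at-j → R-antitone x∈ y∈ ≤-at-j m (suc j))
                               (λ ≥-at-j → R-antitone y∈ x∈ ≥-at-j m (suc j)) ⟩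
    mix (mix t (θ⟨ x ⟩ j) (θ⟨ y ⟩ j)) (mix t (U x m j) (U y m j)) (V x m j)
      ≡⟨ cong (mix (mix t (θ⟨ x ⟩ j) (θ⟨ y ⟩ j)) (mix t (U x m j) (U y m j)))
           (trans (sym (mix-idem t (V x m j))) (cong (mix t (V x m j)) Vx≡Vy)) ⟩
    mix (mix t (θ⟨ x ⟩ j) (θ⟨ y ⟩ j)) (mix t (U x m j) (U y m j)) (mix t (V x m j) (V y m j)) ∎
    where
    open ℚ.≤-Reasoning
    Vx≡Vy : V x m j ≡ V y m j
    Vx≡Vy = reached-cong-≤ j (λ i i≢j → update-≢ θ j i i≢j) m (inject₁ j)
      (ℕ.≤-reflexive (Fin.toℕ-inject₁ j))

  reached-concave : ∀ m k → mix t (R x m k) (R y m k) ≤ R (mix t x y) m k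
  reached-concave zero k = ℚ.≤-reflexive (mix-idem t (R x 0 k))
  reached-concave (suc m) zero = ℚ.≤-reflexive (begin
    mix t (R x (suc m) zero) (R y (suc m) zero)
      ≡⟨ cong₂ (mix t) (reached-zero θ⟨ x ⟩ (suc m)) (reached-zero θ⟨ y ⟩ (suc m)) ⟩
    mix t 1ℚ 1ℚ
      ≡⟨ mix-idem t 1ℚ ⟩
    1ℚ
      ≡⟨ sym (reached-zero θ⟨ mix t x y ⟩ (suc m)) ⟩
    R (mix t x y) (suc m) zero ∎)
    where open ≡-Reasoning
  reached-concave (suc m) (suc k) = begin
    mix t (R x (suc m) (suc k)) (R y (suc m) (suc k))
      ≤⟨ mix-reached-suc-≤ m k ⟩
    mix (mix t (θ⟨ x ⟩ k) (θ⟨ y ⟩ k)) (mix t (U x m k) (U y m k)) (mix t (V x m k) (V y m k))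
      ≤⟨ mix-mono-≤ (mix-∈[0,1] t∈ (update-∈[0,1] θ j θ∈ x∈ k) (update-∈[0,1] θ j θ∈ y∈ k))
           (reached-concave m (suc k)) (reached-concave m (inject₁ k)) ⟩
    mix (mix t (θ⟨ x ⟩ k) (θ⟨ y ⟩ k)) (U z m k) (V z m k)
      ≡⟨ mix-cong-weight (U z m k) (V z m k) (sym (update-mix θ j t x y k)) ⟩
    mix (θ⟨ z ⟩ k) (U z m k) (V z m k)
      ≡⟨ sym (reached-suc θ⟨ z ⟩ m k) ⟩
    R z (suc m) (suc k) ∎
    where
    open ℚ.≤-Reasoning
    z : ℚ
    z = mix t x y

lemma3p5 : (n : ℕ) → 1 Data.Nat.≤ n → (θ : Fin n → ℚ) → (∀ i → 0ℚ ≤ θ i × θ i ≤ 1ℚ) →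
    (j : Fin n) → (x y t : ℚ) →
    0ℚ ≤ x → x ≤ 1ℚ → 0ℚ ≤ y → y ≤ 1ℚ → 0ℚ ≤ t → t ≤ 1ℚ →
    t * 𝓕 (θ [ j ≔ x ]) + (1ℚ - t) * 𝓕 (θ [ j ≔ y ]) ≤ 𝓕 (θ [ j ≔ t * x + (1ℚ - t) * y ])
lemma3p5 n _ θ θ∈ j x y t 0≤x x≤1 0≤y y≤1 0≤t t≤1 = begin
  mix t (𝓕 (θ [ j ≔ x ])) (𝓕 (θ [ j ≔ y ]))
    ≡⟨ cong₂ (mix t) (𝓕≡sumFin-reached (θ [ j ≔ x ])) (𝓕≡sumFin-reached (θ [ j ≔ y ])) ⟩
  mix t (sumFin (λ k → reached (θ [ j ≔ x ]) (suc n) (suc k)))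
        (sumFin (λ k → reached (θ [ j ≔ y ]) (suc n) (suc k)))
    ≤⟨ mix-sumFin-≤ t (λ k →
         reached-concave θ∈ j (0≤t , t≤1) (0≤x , x≤1) (0≤y , y≤1) (suc n) (suc k)) ⟩
  sumFin (λ k → reached (θ [ j ≔ mix t x y ]) (suc n) (suc k))
    ≡⟨ sym (𝓕≡sumFin-reached (θ [ j ≔ mix t x y ])) ⟩
  𝓕 (θ [ j ≔ mix t x y ]) ∎
  where open ℚ.≤-Reasoning
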